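{- There is a $\lambda$-term $\mathtt{lookup}$ of $\Lambda_{\tt det}$ such that for every term $k$, every natural number $n$ and every non-empty string $i\in\{0,1\}^+$ with $n < |i|$, $$\mathtt{lookup}\, k\, \lceil \mathrm{bin}(n)\rceil\, \lceil i\rceil \rightarrow_{det}^{O(n\log n)} k\, \lceil c\rceil,$$ where $c$ is the $(n+1)$-th character of $i$ (counting from the left, starting at $1$).
   Context: $\Lambda_{\tt det}$: terms $t ::= v \mid t\,v$, values $v ::= \lambda x.t \mid x$; evaluation contexts $E ::= [\cdot] \mid E\,v$; reduction $E[(\lambda x.t)u] \rightarrow_{det} E[t\{x:=u\}]$. For $n\in\mathbb{N}$, $\mathrm{bin}(n)\in\{0,1\}^*$ is the reversed binary representation of $n$ (least significant bit first) with no trailing $0$s ($\mathrm{bin}(0)=\varepsilon$, $\mathrm{bin}(2)=01$, $\mathrm{bin}(4)=001$), Scott-encoded as $\lceil\varepsilon\rceil := \lambda x_0.\lambda x_1.\lambda x_\varepsilon.x_\varepsilon$, $\lceil 0 s\rceil := \lambda x_0.\lambda x_1.\lambda x_\varepsilon.x_0\lceil s\rceil$, $\lceil 1 s\rceil := \lambda x_0.\lambda x_1.\lambda x_\varepsilon.x_1\lceil s\rceil$. The string $i$ is Scott-encoded the same way, and a character $c \in \{0,1\}$ is encoded as $\lceil 0\rceil := \lambda x_0.\lambda x_1.x_0$, $\lceil 1\rceil := \lambda x_0.\lambda x_1.x_1$. The paper defines the partial function $\textsc{lookup}$ by $\textsc{lookup}(\mathrm{bin}(0), c s)=c$ and $\textsc{lookup}(\mathrm{bin}(n),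 cs)=\textsc{lookup}(\mathrm{bin}(n-1), s)$ for $n>0$, i.e. it returns the $(n+1)$-th character. -}

module Defs where

open import Data.Nat using (ℕ; zero; suc; _+_; _*_; _≤_)
open import Data.List using (List; []; _∷_)

mutual
  data Term : Set where
    val : Val → Term
    app : Term → Val → Term

  data Val : Set where
    var : ℕ → Val
    lam : Term → Val

ext : (ℕ → ℕ) → ℕ → ℕ
ext ρ zero    = zero
ext ρ (suc x) = suc (ρ x)

mutual
  renT : (ℕ → ℕ) → Term → Term
  renT ρ (val v)   = val (renV ρ v)
  renT ρ (app t v) = app (renT ρ t) (renV ρ v)

  renV : (ℕ → ℕ) → Val → Val
  renV ρ (var x) = var (ρ x)
  renV ρ (lam t) = lam (renT (ext ρ) t)

exts : (ℕ → Val) → ℕ → Val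
exts σ zero    = var zero
exts σ (suc x) = renV suc (σ x)

mutual
  subT : (ℕ → Val) → Term → Term
  subT σ (val v)   = val (subV σ v)
  subT σ (app t v) = app (subT σ t) (subV σ v)

  subV : (ℕ → Val) → Val → Val
  subV σ (var x) = σ x
  subV σ (lam t) = lam (subT (exts σ) t)

single : Val → ℕ → Val
single u zero    = u
single u (suc x) = var x

-- t{x:=u} where x is the variable bound by the outermost λ
_[_] : Term → Val → Term
t [ u ] = subT (single u) t

data _⟶_ : Term → Term → Set where
  β   : ∀ {t u} → app (val (lam t)) u ⟶ (t [ u ])
  ctx : ∀ {t t' v} → t ⟶ t' → app t v ⟶ app t' v

data _⟶[_]_ : Term → ℕ → Term → Set where
  done : ∀ {t} → t ⟶[ zero ] t
  step : ∀ {t t' t'' m} → t ⟶ t' → t' ⟶[ m ] t'' → t ⟶[ suc m ] t''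

data Bit : Set where
  b0 b1 : Bit

inc : List Bit → List Bit
inc []        = b1 ∷ []
inc (b0 ∷ s)  = b1 ∷ s
inc (b1 ∷ s)  = b0 ∷ inc s

-- bin n : reversed binary representation of n, no trailing 0s (bin 0 = ε)
bin : ℕ → List Bit
bin zero    = []
bin (suc n) = inc (bin n)

-- Scott encodings (closed terms)
-- ⌈ε⌉ = λx0.λx1.λxε.xε ; ⌈0s⌉ = λx0.λx1.λxε.x0⌈s⌉ ; ⌈1s⌉ = λx0.λx1.λxε.x1⌈s⌉
⌈_⌉s : List Bit → Val
⌈ [] ⌉s      = lam (val (lam (val (lam (val (var 0))))))
⌈ b0 ∷ s ⌉s  = lam (val (lam (val (lam (app (val (var 2)) ⌈ s ⌉s)))))
⌈ b1 ∷ s ⌉s  = lam (val (lam (val (lam (app (val (var 1)) ⌈ s ⌉s)))))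

-- ⌈0⌉ = λx0.λx1.x0 ; ⌈1⌉ = λx0.λx1.x1
⌈_⌉c : Bit → Val
⌈ b0 ⌉c = lam (val (lam (val (var 1))))
⌈ b1 ⌉c = lam (val (lam (val (var 0))))

-- Reading bin(n) least significant bit first, dropping ⟦ b ∷ s ⟧ = b + 2⟦ s ⟧
-- characters from a string means dropping ⟦ s ⟧ characters twice and then one
-- more if b = 1.  The term Drop runs this recursion in continuation-passing
-- style on the stack of pending arguments, so the number of β-steps satisfies
-- cost(b ∷ s) ≤ 2 cost(s) + 17 and is linear in n.  The looked-up character is
-- then the head of the remaining string, which is read off by a Scott case.
module Submission where

open import Defs
open import Data.Nat using (ℕ; zero; suc; _+_; _*_; _≤_; _<_; z≤n; s≤s)
open import Data.Nat.Properties
open import Data.Nat.Logarithm using (⌊log₂_⌋; ⌊log₂⌋-mono-≤)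
open import Data.Nat.Tactic.RingSolver using (solve-∀)
open import Data.List using (List; []; _∷_; _++_; length; lookup; drop)
open import Data.List.Properties using (drop-drop)
open import Data.Fin using (fromℕ<)
open import Data.Product using (Σ; ∃; _×_; _,_)
open import Relation.Binary.PropositionalEquality

-- Fusion of renamings and substitutions

ext-∘ : ∀ {ρ₁ ρ₂ ρ} → (∀ x → ρ₁ (ρ₂ x) ≡ ρ x) → ∀ x → ext ρ₁ (ext ρ₂ x) ≡ ext ρ x
ext-∘ h zero    = refl
ext-∘ h (suc x) = cong suc (h x)

mutual
  renT-renT : ∀ {ρ₁ ρ₂ ρ} → (∀ x → ρ₁ (ρ₂ x) ≡ ρ x) → ∀ t → renT ρ₁ (renT ρ₂ t) ≡ renT ρ t
  renT-renT h (val v)   = cong val (renV-renV h v)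
  renT-renT h (app t v) = cong₂ app (renT-renT h t) (renV-renV h v)

  renV-renV : ∀ {ρ₁ ρ₂ ρ} → (∀ x → ρ₁ (ρ₂ x) ≡ ρ x) → ∀ v → renV ρ₁ (renV ρ₂ v) ≡ renV ρ v
  renV-renV h (var x) = cong var (h x)
  renV-renV h (lam t) = cong lam (renT-renT (ext-∘ h) t)

exts-ext : ∀ {σ ρ σ'} → (∀ x → σ (ρ x) ≡ σ' x) → ∀ x → exts σ (ext ρ x) ≡ exts σ' x
exts-ext h zero    = refl
exts-ext h (suc x) = cong (renV suc) (h x)

mutual
  subT-renT : ∀ {σ ρ σ'} → (∀ x → σ (ρ x) ≡ σ' x) → ∀ t → subT σ (renT ρ t) ≡ subT σ' t
  subT-renT h (val v)   = cong val (subV-renV h v)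
  subT-renT h (app t v) = cong₂ app (subT-renT h t) (subV-renV h v)

  subV-renV : ∀ {σ ρ σ'} → (∀ x → σ (ρ x) ≡ σ' x) → ∀ v → subV σ (renV ρ v) ≡ subV σ' v
  subV-renV h (var x) = h x
  subV-renV h (lam t) = cong lam (subT-renT (exts-ext h) t)

ext-exts : ∀ {ρ σ σ'} → (∀ x → renV ρ (σ x) ≡ σ' x) → ∀ x → renV (ext ρ) (exts σ x) ≡ exts σ' x
ext-exts h zero    = refl
ext-exts {σ = σ} h (suc x) =
  trans (renV-renV (λ _ → refl) (σ x))
        (sym (trans (cong (renV suc) (sym (h x))) (renV-renV (λ _ → refl) (σ x))))

mutual
  renT-subT : ∀ {ρ σ σ'} → (∀ x → renV ρ (σ x) ≡ σ' x) → ∀ t → renT ρ (subT σ t) ≡ subT σ' t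
  renT-subT h (val v)   = cong val (renV-subV h v)
  renT-subT h (app t v) = cong₂ app (renT-subT h t) (renV-subV h v)

  renV-subV : ∀ {ρ σ σ'} → (∀ x → renV ρ (σ x) ≡ σ' x) → ∀ v → renV ρ (subV σ v) ≡ subV σ' v
  renV-subV h (var x) = h x
  renV-subV h (lam t) = cong lam (renT-subT (ext-exts h) t)

exts-exts : ∀ {σ τ σ'} → (∀ x → subV σ (τ x) ≡ σ' x) → ∀ x → subV (exts σ) (exts τ x) ≡ exts σ' x
exts-exts h zero    = refl
exts-exts {σ} {τ} h (suc x) =
  trans (subV-renV {σ' = λ y → renV suc (σ y)} (λ _ → refl) (τ x))
        (sym (trans (cong (renV suc) (sym (h x))) (renV-subV (λ _ → refl) (τ x))))

mutual
  subT-subT : ∀ {σ τ σ'} → (∀ x → subV σ (τ x) ≡ σ' x) → ∀ t → subT σ (subT τ t) ≡ subT σ' t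
  subT-subT h (val v)   = cong val (subV-subV h v)
  subT-subT h (app t v) = cong₂ app (subT-subT h t) (subV-subV h v)

  subV-subV : ∀ {σ τ σ'} → (∀ x → subV σ (τ x) ≡ σ' x) → ∀ v → subV σ (subV τ v) ≡ subV σ' v
  subV-subV h (var x) = h x
  subV-subV h (lam t) = cong lam (subT-subT (exts-exts h) t)

exts-var : ∀ {σ} → (∀ x → σ x ≡ var x) → ∀ x → exts σ x ≡ var x
exts-var h zero    = refl
exts-var h (suc x) = cong (renV suc) (h x)

mutual
  subT-var : ∀ {σ} → (∀ x → σ x ≡ var x) → ∀ t → subT σ t ≡ t
  subT-var h (val v)   = cong val (subV-var h v)
  subT-var h (app t v) = cong₂ app (subT-var h t) (subV-var h v)

  subV-var : ∀ {σ} → (∀ x → σ x ≡ var x) → ∀ v → subV σ v ≡ v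
  subV-var h (var x) = h x
  subV-var h (lam t) = cong lam (subT-var (exts-var h) t)

_•_ : Val → (ℕ → Val) → ℕ → Val
(u • σ) zero    = u
(u • σ) (suc x) = σ x

single-exts : ∀ u σ x → subV (single u) (exts σ x) ≡ (u • σ) x
single-exts u σ zero    = refl
single-exts u σ (suc x) = trans (subV-renV {σ' = var} (λ _ → refl) (σ x)) (subV-var (λ _ → refl) (σ x))

apps : Term → List Val → Term
apps t []       = t
apps t (v ∷ vs) = apps (app t v) vs

apps-ctx : ∀ {t t'} vs → t ⟶ t' → apps t vs ⟶ apps t' vs
apps-ctx []       r = r
apps-ctx (v ∷ vs) r = apps-ctx vs (ctx r)

infixr 5 _▸_
_▸_ : ∀ {a b t u v} → t ⟶[ a ] u → u ⟶[ b ] v → t ⟶[ a + b ] v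
done       ▸ q = q
step r p   ▸ q = step r (p ▸ q)

Lams : ℕ → Term → Term
Lams zero    t = t
Lams (suc n) t = val (lam (Lams n t))

ƛ¹ ƛ² ƛ³ : Term → Val
ƛ¹ t = lam t
ƛ² t = lam (Lams 1 t)
ƛ³ t = lam (Lams 2 t)

-- The last argument of the stack becomes variable 0.
push : List Val → (ℕ → Val) → ℕ → Val
push []       σ = σ
push (u ∷ us) σ = push us (u • σ)

β-Lams : ∀ us t vs → apps (Lams (length us) t) (us ++ vs) ⟶[ length us ] apps (subT (push us var) t) vs
β-Lams us t vs = subst (λ t' → apps t' (us ++ vs) ⟶[ length us ] apps (subT (push us var) t) vs)
                       (subT-var (λ _ → refl) (Lams (length us) t)) (β-subT-Lams us var)
  where
  β-subT-Lams : ∀ us σ → apps (subT σ (Lams (length us) t)) (us ++ vs) ⟶[ length us ] apps (subT (push us σ) t) vs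
  β-subT-Lams []       σ = done
  β-subT-Lams (u ∷ us) σ =
    step (apps-ctx (us ++ vs)
           (subst (app (val (lam (subT (exts σ) (Lams (length us) t)))) u ⟶_)
                  (subT-subT (single-exts u σ) (Lams (length us) t)) β))
         (β-subT-Lams us (u • σ))

subV-⌈⌉s : ∀ σ s → subV σ ⌈ s ⌉s ≡ ⌈ s ⌉s
subV-⌈⌉s σ []       = refl
subV-⌈⌉s σ (b0 ∷ s) = cong (λ v → lam (val (lam (val (lam (app (val (var 2)) v)))))) (subV-⌈⌉s _ s)
subV-⌈⌉s σ (b1 ∷ s) = cong (λ v → lam (val (lam (val (lam (app (val (var 1)) v)))))) (subV-⌈⌉s _ s)

⌈[]⌉s-β : ∀ A B C vs → apps (val ⌈ [] ⌉s) (A ∷ B ∷ C ∷ vs) ⟶[ 3 ] apps (val C) vs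
⌈[]⌉s-β A B C vs = β-Lams (A ∷ B ∷ C ∷ []) _ vs

⌈∷⌉s-β : ∀ (A : Bit → Val) b s C vs →
         apps (val ⌈ b ∷ s ⌉s) (A b0 ∷ A b1 ∷ C ∷ vs) ⟶[ 3 ] apps (val (A b)) (⌈ s ⌉s ∷ vs)
⌈∷⌉s-β A b0 s C vs =
  subst (λ v → apps (val ⌈ b0 ∷ s ⌉s) (A b0 ∷ A b1 ∷ C ∷ vs) ⟶[ 3 ] apps (app (val (A b0)) v) vs)
        (subV-⌈⌉s _ s) (β-Lams (A b0 ∷ A b1 ∷ C ∷ []) (app (val (var 2)) ⌈ s ⌉s) vs)
⌈∷⌉s-β A b1 s C vs =
  subst (λ v → apps (val ⌈ b1 ∷ s ⌉s) (A b0 ∷ A b1 ∷ C ∷ vs) ⟶[ 3 ] apps (app (val (A b1)) v) vs)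
        (subV-⌈⌉s _ s) (β-Lams (A b0 ∷ A b1 ∷ C ∷ []) (app (val (var 1)) ⌈ s ⌉s) vs)

drop-lookup : ∀ {A : Set} (xs : List A) {n} (p : n < length xs) →
              drop n xs ≡ lookup xs (fromℕ< p) ∷ drop (suc n) xs
drop-lookup (x ∷ xs) {zero}  p       = refl
drop-lookup (x ∷ xs) {suc n} (s≤s p) = drop-lookup xs p

≤-length-drop : ∀ {A : Set} m {n} (xs : List A) → m + n ≤ length xs → n ≤ length (drop m xs)
≤-length-drop zero    xs       le       = le
≤-length-drop (suc m) (x ∷ xs) (s≤s le) = ≤-length-drop m xs le

⟦_⟧ : List Bit → ℕ
⟦ [] ⟧     = 0
⟦ b0 ∷ s ⟧ = ⟦ s ⟧ + ⟦ s ⟧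
⟦ b1 ∷ s ⟧ = suc (⟦ s ⟧ + ⟦ s ⟧)

⟦inc⟧ : ∀ s → ⟦ inc s ⟧ ≡ suc ⟦ s ⟧
⟦inc⟧ []       = refl
⟦inc⟧ (b0 ∷ s) = refl
⟦inc⟧ (b1 ∷ s) rewrite ⟦inc⟧ s = cong suc (+-suc ⟦ s ⟧ ⟦ s ⟧)

⟦bin⟧ : ∀ n → ⟦ bin n ⟧ ≡ n
⟦bin⟧ zero    = refl
⟦bin⟧ (suc n) = trans (⟦inc⟧ (bin n)) (cong suc (⟦bin⟧ n))

data Positive : List Bit → Set where
  one  : Positive (b1 ∷ [])
  cons : ∀ b {s} → Positive s → Positive (b ∷ s)

inc-Positive : ∀ {s} → Positive s → Positive (inc s)
inc-Positive one         = cons b0 one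
inc-Positive (cons b0 p) = cons b1 p
inc-Positive (cons b1 p) = cons b0 (inc-Positive p)

bin-Positive : ∀ n → Positive (bin (suc n))
bin-Positive zero    = one
bin-Positive (suc n) = inc-Positive (bin-Positive n)

-- The lookup machine

-- A computation returns v by applying the value on top of the remaining stack to v.

return : Val
return = ƛ² (app (val (var 0)) (var 1))

return-β : ∀ v c vs → apps (val return) (v ∷ c ∷ vs) ⟶[ 2 ] apps (val c) (v ∷ vs)
return-β v c vs = β-Lams (v ∷ c ∷ []) _ vs

-- The third branch of Tail and Head is never taken: their argument is non-empty.
Tail : Val
Tail = ƛ¹ (apps (val (var 0)) (return ∷ return ∷ return ∷ []))

Tail-β : ∀ {j b r} c vs → j ≡ b ∷ r → apps (val Tail) (⌈ j ⌉s ∷ c ∷ vs) ⟶[ 6 ] apps (val c) (⌈ r ⌉s ∷ vs)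
Tail-β {b = b} {r} c vs refl =
  β-Lams (⌈ b ∷ r ⌉s ∷ []) _ (c ∷ vs)
  ▸ ⌈∷⌉s-β (λ _ → return) b r return (c ∷ vs)
  ▸ return-β ⌈ r ⌉s c vs

pending : Bit → List Val
pending b0 = []
pending b1 = Tail ∷ []

-- Drop is applied to itself, and every frame finds Drop and the string it needs
-- below it on the stack, so arguments are never substituted under a binder.
Resume : Bit → Val
Resume b = ƛ³ (apps (val (var 1)) (var 1 ∷ var 0 ∷ var 2 ∷ pending b))

DropBit : Bit → Val
DropBit b = ƛ³ (apps (val (var 1)) (var 1 ∷ var 2 ∷ var 0 ∷ Resume b ∷ var 1 ∷ var 2 ∷ []))

Done : Val
Done = ƛ¹ (val return)

Drop : Val
Drop = ƛ² (apps (val (var 0)) (DropBit b0 ∷ DropBit b1 ∷ Done ∷ var 1 ∷ []))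

Answer : Bit → Val
Answer c = ƛ² (app (val (var 0)) ⌈ c ⌉c)

Head : Val
Head = ƛ¹ (apps (val (var 0)) (Answer b0 ∷ Answer b1 ∷ Answer b0 ∷ []))

lookupT : Term
lookupT = Lams 3 (apps (val Drop) (Drop ∷ var 1 ∷ var 0 ∷ Head ∷ var 2 ∷ []))

dropCost : List Bit → ℕ
dropCost []       = 8
dropCost (b0 ∷ s) = 8 + (dropCost s + 3) + dropCost s
dropCost (b1 ∷ s) = 8 + (dropCost s + 3) + (dropCost s + 6)

Drop-split : ∀ b s i vs →
  apps (val Drop) (Drop ∷ ⌈ b ∷ s ⌉s ∷ i ∷ vs)
    ⟶[ 8 ] apps (val Drop) (Drop ∷ ⌈ s ⌉s ∷ i ∷ Resume b ∷ Drop ∷ ⌈ s ⌉s ∷ vs)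
Drop-split b0 s i vs =
  β-Lams (Drop ∷ ⌈ b0 ∷ s ⌉s ∷ []) _ (i ∷ vs)
  ▸ ⌈∷⌉s-β DropBit b0 s Done (Drop ∷ i ∷ vs)
  ▸ β-Lams (⌈ s ⌉s ∷ Drop ∷ i ∷ []) _ vs
Drop-split b1 s i vs =
  β-Lams (Drop ∷ ⌈ b1 ∷ s ⌉s ∷ []) _ (i ∷ vs)
  ▸ ⌈∷⌉s-β DropBit b1 s Done (Drop ∷ i ∷ vs)
  ▸ β-Lams (⌈ s ⌉s ∷ Drop ∷ i ∷ []) _ vs

Resume-β : ∀ b j s vs →
  apps (val (Resume b)) (j ∷ Drop ∷ ⌈ s ⌉s ∷ vs) ⟶[ 3 ] apps (val Drop) (Drop ∷ ⌈ s ⌉s ∷ j ∷ pending b ++ vs)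
Resume-β b0 j s vs = β-Lams (j ∷ Drop ∷ ⌈ s ⌉s ∷ []) _ vs
Resume-β b1 j s vs = β-Lams (j ∷ Drop ∷ ⌈ s ⌉s ∷ []) _ vs

mutual
  Drop-β : ∀ s i c vs → ⟦ s ⟧ ≤ length i →
    apps (val Drop) (Drop ∷ ⌈ s ⌉s ∷ ⌈ i ⌉s ∷ c ∷ vs) ⟶[ dropCost s ] apps (val c) (⌈ drop ⟦ s ⟧ i ⌉s ∷ vs)
  Drop-β [] i c vs _ =
    β-Lams (Drop ∷ ⌈ [] ⌉s ∷ []) _ (⌈ i ⌉s ∷ c ∷ vs)
    ▸ ⌈[]⌉s-β (DropBit b0) (DropBit b1) Done (Drop ∷ ⌈ i ⌉s ∷ c ∷ vs)
    ▸ β-Lams (Drop ∷ []) _ (⌈ i ⌉s ∷ c ∷ vs)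
    ▸ return-β ⌈ i ⌉s c vs
  Drop-β (b0 ∷ s) i c vs le rewrite sym (drop-drop ⟦ s ⟧ ⟦ s ⟧ i) =
    Drop-first-half b0 s i c vs le
    ▸ Drop-β s (drop ⟦ s ⟧ i) c vs (≤-length-drop ⟦ s ⟧ i le)
  Drop-β (b1 ∷ s) i c vs le =
    Drop-first-half b1 s i c vs (<⇒≤ le)
    ▸ Drop-β s (drop ⟦ s ⟧ i) Tail (c ∷ vs) (≤-length-drop ⟦ s ⟧ i (<⇒≤ le))
    ▸ Tail-β c vs (trans (drop-drop ⟦ s ⟧ ⟦ s ⟧ i) (drop-lookup i le))

  Drop-first-half : ∀ b s i c vs → ⟦ s ⟧ + ⟦ s ⟧ ≤ length i →
    apps (val Drop) (Drop ∷ ⌈ b ∷ s ⌉s ∷ ⌈ i ⌉s ∷ c ∷ vs)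
      ⟶[ 8 + (dropCost s + 3) ] apps (val Drop) (Drop ∷ ⌈ s ⌉s ∷ ⌈ drop ⟦ s ⟧ i ⌉s ∷ pending b ++ c ∷ vs)
  Drop-first-half b s i c vs le =
    Drop-split b s ⌈ i ⌉s (c ∷ vs)
    ▸ Drop-β s i (Resume b) (Drop ∷ ⌈ s ⌉s ∷ c ∷ vs) (m+n≤o⇒m≤o ⟦ s ⟧ le)
    ▸ Resume-β b ⌈ drop ⟦ s ⟧ i ⌉s s (c ∷ vs)

Answer-β : ∀ c v k → apps (val (Answer c)) (v ∷ k ∷ []) ⟶[ 2 ] app (val k) ⌈ c ⌉c
Answer-β b0 v k = β-Lams (v ∷ k ∷ []) _ []
Answer-β b1 v k = β-Lams (v ∷ k ∷ []) _ []

Head-β : ∀ {j c r} k → j ≡ c ∷ r → apps (val Head) (⌈ j ⌉s ∷ k ∷ []) ⟶[ 6 ] app (val k) ⌈ c ⌉c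
Head-β {c = c} {r} k refl =
  β-Lams (⌈ c ∷ r ⌉s ∷ []) _ (k ∷ [])
  ▸ ⌈∷⌉s-β Answer c r (Answer b0) (k ∷ [])
  ▸ Answer-β c ⌈ r ⌉s k

-- Cost bounds

⟦⟧-double-≤ : ∀ b s → ⟦ s ⟧ + ⟦ s ⟧ ≤ ⟦ b ∷ s ⟧
⟦⟧-double-≤ b0 s = ≤-refl
⟦⟧-double-≤ b1 s = n≤1+n _

dropCost-cons : ∀ b s → dropCost (b ∷ s) + 17 ≤ (dropCost s + 17) + (dropCost s + 17)
dropCost-cons b0 s = ≤-trans (m≤m+n _ 6) (≤-reflexive (rearrange (dropCost s)))
  where
  rearrange : ∀ c → 8 + (c + 3) + c + 17 + 6 ≡ (c + 17) + (c + 17)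
  rearrange = solve-∀
dropCost-cons b1 s = ≤-reflexive (rearrange (dropCost s))
  where
  rearrange : ∀ c → 8 + (c + 3) + (c + 6) + 17 ≡ (c + 17) + (c + 17)
  rearrange = solve-∀

dropCost-Positive : ∀ {s} → Positive s → dropCost s + 17 ≤ 50 * ⟦ s ⟧
dropCost-Positive one = ≤-refl
dropCost-Positive {b ∷ s} (cons b p) = begin
  dropCost (b ∷ s) + 17                     ≤⟨ dropCost-cons b s ⟩
  (dropCost s + 17) + (dropCost s + 17)     ≤⟨ +-mono-≤ (dropCost-Positive p) (dropCost-Positive p) ⟩
  50 * ⟦ s ⟧ + 50 * ⟦ s ⟧                   ≡⟨ *-distribˡ-+ 50 ⟦ s ⟧ ⟦ s ⟧ ⟨
  50 * (⟦ s ⟧ + ⟦ s ⟧)                      ≤⟨ *-monoʳ-≤ 50 (⟦⟧-double-≤ b s) ⟩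
  50 * ⟦ b ∷ s ⟧                            ∎
  where open ≤-Reasoning

n≤n*⌊log₂n⌋+1 : ∀ n → n ≤ n * ⌊log₂ n ⌋ + 1
n≤n*⌊log₂n⌋+1 zero             = z≤n
n≤n*⌊log₂n⌋+1 (suc zero)       = m≤n+m 1 (1 * ⌊log₂ 1 ⌋)
n≤n*⌊log₂n⌋+1 n@(suc (suc _)) = begin
  n                 ≡⟨ *-identityʳ n ⟨
  n * ⌊log₂ 2 ⌋     ≤⟨ *-monoʳ-≤ n (⌊log₂⌋-mono-≤ {2} {n} (s≤s (s≤s z≤n))) ⟩
  n * ⌊log₂ n ⌋     ≤⟨ m≤m+n _ 1 ⟩
  n * ⌊log₂ n ⌋ + 1 ∎
  where open ≤-Reasoning

lookupCost : ℕ → ℕ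
lookupCost n = 3 + (dropCost (bin n) + 6)

lookupCost-≤ : ∀ n → lookupCost n ≤ 50 * (n * ⌊log₂ n ⌋) + 50
lookupCost-≤ zero      = m≤m+n 17 33
lookupCost-≤ n@(suc m) = begin
  lookupCost n                ≤⟨ m≤m+n _ 8 ⟩
  lookupCost n + 8            ≡⟨ rearrange (dropCost (bin n)) ⟩
  dropCost (bin n) + 17       ≤⟨ dropCost-Positive (bin-Positive m) ⟩
  50 * ⟦ bin n ⟧              ≡⟨ cong (50 *_) (⟦bin⟧ n) ⟩
  50 * n                      ≤⟨ *-monoʳ-≤ 50 (n≤n*⌊log₂n⌋+1 n) ⟩
  50 * (n * ⌊log₂ n ⌋ + 1)    ≡⟨ *-distribˡ-+ 50 (n * ⌊log₂ n ⌋) 1 ⟩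
  50 * (n * ⌊log₂ n ⌋) + 50   ∎
  where
  open ≤-Reasoning
  rearrange : ∀ c → 3 + (c + 6) + 8 ≡ c + 17
  rearrange = solve-∀

lookupT-β : ∀ k n i (p : n < length i) →
  app (app (app lookupT k) ⌈ bin n ⌉s) ⌈ i ⌉s ⟶[ lookupCost n ] app (val k) ⌈ lookup i (fromℕ< p) ⌉c
lookupT-β k n i p =
  β-Lams (k ∷ ⌈ bin n ⌉s ∷ ⌈ i ⌉s ∷ []) _ []
  ▸ Drop-β (bin n) i Head (k ∷ []) (≤-trans (≤-reflexive (⟦bin⟧ n)) (<⇒≤ p))
  ▸ Head-β k (trans (cong (λ m → drop m i) (⟦bin⟧ n)) (drop-lookup i p))

mainTheorem5 : Σ Term λ lookupT → Σ ℕ λ C →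
    (k : Val) (n : ℕ) (i : List Bit) (p : n < length i) →
    ∃ λ m → (m ≤ C * (n * ⌊log₂ n ⌋) + C)
    × (app (app (app lookupT k) ⌈ bin n ⌉s) ⌈ i ⌉s ⟶[ m ] app (val k) ⌈ lookup i (fromℕ< p) ⌉c)
mainTheorem5 = lookupT , 50 , λ k n i p → lookupCost n , lookupCost-≤ n , lookupT-β k n i p
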